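{- For every integer $\Delta\geq 1$ there exists $G\in\mathcal{M}(\mathcal{C})$ with maximum degree $\Delta(G)\geq\Delta$.
   Context: All graphs are finite and simple. $\mathcal{R}(\mathcal{C})$ is the class of graphs $G$ such that every $2$-colouring of the edges of $G$ admits a monochromatic cycle (of any length). $\mathcal{M}(\mathcal{C})$ is the class of graphs in $\mathcal{R}(\mathcal{C})$ no proper subgraph of which is in $\mathcal{R}(\mathcal{C})$. -}

module Defs where

open import Data.Nat using (ℕ; suc; _+_; _≤_; _⊔_)
open import Data.Nat.DivMod using (_%_; m%n<n)
open import Data.Bool using (Bool; true; false)
open import Data.Fin using (Fin; toℕ; fromℕ<)
open import Data.List using (List; length; map; foldr; filterᵇ; allFin)
open import Data.Product using (Σ; ∃; _×_; _,_)
open import Data.Sum using (_⊎_)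
open import Relation.Binary.PropositionalEquality using (_≡_)
open import Relation.Nullary using (¬_)
open import Function.Definitions using (Injective)

record Graph (n : ℕ) : Set where
  field
    V     : Fin n → Bool
    E     : Fin n → Fin n → Bool
    sym   : ∀ x y → E x y ≡ E y x
    irr   : ∀ x → E x x ≡ false
    E⇒V   : ∀ x y → E x y ≡ true → V x ≡ true
open Graph public

record Colouring (n : ℕ) : Set where
  field
    col  : Fin n → Fin n → Bool
    csym : ∀ x y → col x y ≡ col y x
open Colouring public

next : ∀ {k} → Fin (suc k) → Fin (suc k)
next {k} i = fromℕ< (m%n<n (suc (toℕ i)) (suc k))

MonoCycle : ∀ {n} → Graph n → Colouring n → Set
MonoCycle {n} G c =
  Σ Bool λ b → Σ ℕ λ m → Σ (Fin (3 + m) → Fin n) λ f →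
    Injective _≡_ _≡_ f ×
    (∀ i → (E G (f i) (f (next i)) ≡ true) × (col c (f i) (f (next i)) ≡ b))

InR : ∀ {n} → Graph n → Set
InR {n} G = (c : Colouring n) → MonoCycle G c

ProperSubgraph : ∀ {n} → Graph n → Graph n → Set
ProperSubgraph {n} H G =
  (∀ x → V H x ≡ true → V G x ≡ true) ×
  (∀ x y → E H x y ≡ true → E G x y ≡ true) ×
  ((∃ λ x → (V G x ≡ true) × (V H x ≡ false)) ⊎
   (∃ λ x → ∃ λ y → (E G x y ≡ true) × (E H x y ≡ false)))

InM : ∀ {n} → Graph n → Set
InM {n} G = InR G × ((H : Graph n) → ProperSubgraph H G → ¬ InR H)

degree : ∀ {n} → Graph n → Fin n → ℕ
degree {n} G v = length (filterᵇ (E G v) (allFin n))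

maxDegree : ∀ {n} → Graph n → ℕ
maxDegree {n} G = foldr _⊔_ 0 (map (degree G) (allFin n))

-- The witness is the wheel with hub 0 and rim 1, 2, …, k (k = Δ + 4) plus the chord 1–3: it has
-- k + 1 vertices and 2k + 1 edges, and the hub has degree k.
--
-- It lies in R(C): add the vertices in the order 0, 1, …, k and follow the colour classes in a
-- colouring without monochromatic cycle. After vertex 1 one class connects the prefix and the
-- other has two components; the K₄ on 0, 1, 2, 3 makes both classes connected; every further rim
-- vertex has two earlier neighbours, and its two edges must differ in colour, which keeps both
-- classes connected; finally vertex k has three earlier neighbours 0, k − 1 and 1, two of its edges
-- share a colour, and together with a path of that colour they close a cycle.
--
-- It is minimal: after deleting any edge the remaining edges are covered by two forests, each
-- certified by a parent function and a rank decreasing towards the parent. Colour one forest true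
-- and the rest false; on a monochromatic cycle both neighbours of a vertex of largest rank would be
-- its parent, which is impossible on a cycle of length at least three.

module Submission where

open import Defs renaming (sym to E-sym)
open import Data.Bool using (Bool; true; false; not; if_then_else_; T)
open import Data.Bool.Properties using (∨-comm; not-involutive)
open import Data.Empty using (⊥; ⊥-elim)
open import Data.Fin using (Fin; toℕ; fromℕ<; fromℕ; inject₁; #_) renaming (zero to fzero; suc to fsuc)
open import Data.Fin.Properties using (toℕ-injective; toℕ-fromℕ<; toℕ-fromℕ; toℕ-inject₁; toℕ<n)
  renaming (_≟_ to _≟ᶠ_)
open import Data.List using (List; []; _∷_; length; lookup; allFin; filterᵇ; tabulate; foldr)
open import Data.List.Extrema.Nat using (argmax; f[xs]≤f[argmax])
open import Data.List.Membership.Propositional using (_∈_; _∉_)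
open import Data.List.Membership.Propositional.Properties using (∈-lookup; ∈-allFin; ∈-map⁺)
open import Data.List.Properties using (filter-all; length-tabulate)
open import Data.List.Relation.Binary.Subset.Propositional using (_⊆_)
open import Data.List.Relation.Binary.Subset.Propositional.Properties using (∷⁺ʳ)
open import Data.List.Relation.Unary.All as All using (All; []; _∷_)
open import Data.List.Relation.Unary.All.Properties using (¬Any⇒All¬; tabulate⁺)
open import Data.List.Relation.Unary.AllPairs as AllPairs using ([]; _∷_)
open import Data.List.Relation.Unary.Any using (here; there)
open import Data.List.Relation.Unary.Unique.Propositional using (Unique)
open import Data.Nat using (ℕ; zero; suc; _+_; _∸_; _⊔_; _≤_; _<_; z≤n; s≤s; s≤s⁻¹; _<?_; _≟_)
open import Data.Nat.DivMod using (_%_; n%n≡0; m<n⇒m%n≡m)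
open import Data.Nat.Properties
  using ( _≤?_; ≤-refl; ≤-reflexive; ≤-trans; ≤-antisym; <⇒≤; <⇒≱; ≮⇒≥; ≤∧≢⇒<; <-irrefl
        ; <-cmp        ; n≤1+n; n<1+n; 1+n≰n; 1+n≢n; m≤n⇒m≤1+n; m<n⇒m<1+n; m≤n⇒m<n∨m≡n; suc-injective
        ; m≤n+m; +-monoʳ-≤; m+n∸n≡m; ∸-monoʳ-<; m≤m⊔n; m≤n⊔m; m⊓n≤n; m≤n⇒m⊓n≡m )
open import Data.Product using (Σ; _×_; _,_; proj₁; proj₂; uncurry)
open import Data.Sum as Sum using (_⊎_; inj₁; inj₂; [_,_]′)
open import Data.Unit using (tt)
open import Function using (id; _∘_)
open import Relation.Binary.Definitions using (tri<; tri≈; tri>)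
open import Relation.Binary.PropositionalEquality
open import Relation.Nullary using (¬_; Dec; yes; no)
open import Relation.Nullary.Decidable using (does; T?; dec-true; dec-false; _×-dec_; _⊎-dec_)

true≢false : true ≢ false
true≢false ()

bool-split : ∀ b β → b ≡ β ⊎ b ≡ not β
bool-split false false = inj₁ refl
bool-split false true = inj₂ refl
bool-split true false = inj₂ refl
bool-split true true = inj₁ refl

bool-cases : ∀ {P : Bool → Set} β → P β → P (not β) → ∀ δ → P δ
bool-cases β pβ p¬β δ with bool-split δ β
... | inj₁ refl = pβ
... | inj₂ refl = p¬β

dec-true⁻¹ : ∀ {A : Set} (a? : Dec A) → does a? ≡ true → A
dec-true⁻¹ (yes a) _ = a
dec-true⁻¹ (no _) ()

dec-false⁻¹ : ∀ {A : Set} (a? : Dec A) → does a? ≡ false → ¬ A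
dec-false⁻¹ (yes _) ()
dec-false⁻¹ (no ¬a) _ = ¬a

lookup-injective : ∀ {n} {xs : List (Fin n)} → Unique xs → ∀ i j → lookup xs i ≡ lookup xs j → i ≡ j
lookup-injective (_ ∷ _) fzero fzero _ = refl
lookup-injective (x∉ ∷ _) fzero (fsuc j) eq = ⊥-elim (All.lookup x∉ (∈-lookup j) eq)
lookup-injective (x∉ ∷ _) (fsuc i) fzero eq = ⊥-elim (All.lookup x∉ (∈-lookup i) (sym eq))
lookup-injective (_ ∷ u) (fsuc i) (fsuc j) eq = cong fsuc (lookup-injective u i j eq)

argmax-Fin : ∀ {k} (r : Fin (suc k) → ℕ) → Σ (Fin (suc k)) λ top → ∀ i → r i ≤ r top
argmax-Fin {k} r = top , λ i → All.lookup (f[xs]≤f[argmax] {f = r} fzero (allFin (suc k))) (∈-allFin i)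
  where
  top = argmax r fzero (allFin (suc k))

≤-foldr-⊔ : ∀ {x xs} → x ∈ xs → x ≤ foldr _⊔_ 0 xs
≤-foldr-⊔ (here refl) = m≤m⊔n _ _
≤-foldr-⊔ {xs = y ∷ _} (there x∈xs) = ≤-trans (≤-foldr-⊔ x∈xs) (m≤n⊔m y _)

degree≤maxDegree : ∀ {n} (G : Graph n) v → degree G v ≤ maxDegree G
degree≤maxDegree G v = ≤-foldr-⊔ (∈-map⁺ (degree G) (∈-allFin v))

module CyclicSuccessor {m : ℕ} where

  next-cases : (i : Fin (3 + m)) →
    (suc (toℕ i) < 3 + m × toℕ (next i) ≡ suc (toℕ i)) ⊎ (suc (toℕ i) ≡ 3 + m × toℕ (next i) ≡ 0)
  next-cases i with suc (toℕ i) <? 3 + m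
  ... | yes lt = inj₁ (lt , trans (toℕ-fromℕ< _) (m<n⇒m%n≡m lt))
  ... | no ≮ = inj₂ (last , trans (toℕ-fromℕ< _) (trans (cong (_% (3 + m)) last) (n%n≡0 (3 + m))))
    where
    last : suc (toℕ i) ≡ 3 + m
    last = ≤-antisym (toℕ<n i) (≮⇒≥ ≮)

  prev : Fin (3 + m) → Fin (3 + m)
  prev fzero = fromℕ (2 + m)
  prev (fsuc i) = inject₁ i

  next-prev : ∀ i → next (prev i) ≡ i
  next-prev fzero = toℕ-injective (trans (toℕ-fromℕ< _)
    (trans (cong (λ t → suc t % (3 + m)) (toℕ-fromℕ (2 + m))) (n%n≡0 (3 + m))))
  next-prev (fsuc i) = toℕ-injective (trans (toℕ-fromℕ< _)
    (trans (cong (λ t → suc t % (3 + m)) (toℕ-inject₁ i)) (m<n⇒m%n≡m (s≤s (toℕ<n i)))))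

  next-next≢ : ∀ i → next (next i) ≢ i
  next-next≢ i eq with next-cases i | next-cases (next i) | cong toℕ eq
  ... | inj₁ (_ , e₁) | inj₁ (_ , e₂) | e = t≢2+t (trans (sym e) (trans e₂ (cong suc e₁)))
    where
    t≢2+t : ∀ {t} → t ≢ suc (suc t)
    t≢2+t ()
  ... | inj₁ (_ , e₁) | inj₂ (last , e₂) | e = 0+2≢N (trans (sym e) e₂) (trans (cong suc (sym e₁)) last)
    where
    0+2≢N : ∀ {t} → t ≡ 0 → suc (suc t) ≢ 3 + m
    0+2≢N refl ()
  ... | inj₂ (last , e₁) | inj₁ (_ , e₂) | e = 1+1≢N (trans (sym e) (trans e₂ (cong suc e₁))) last
    where
    1+1≢N : ∀ {t} → t ≡ 1 → suc t ≢ 3 + m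
    1+1≢N refl ()
  ... | inj₂ (_ , e₁) | inj₂ (last , _) | _ = 1≢N (trans (cong suc (sym e₁)) last)
    where
    1≢N : 1 ≢ 3 + m
    1≢N ()

record Forest : Set where
  field
    parent : ℕ → ℕ
    rank   : ℕ → ℕ
open Forest

Link : Forest → ℕ → ℕ → Set
Link F a b = parent F a ≡ b × rank F b < rank F a

Linked : Forest → ℕ → ℕ → Set
Linked F a b = Link F a b ⊎ Link F b a

link? : ∀ F a b → Dec (Link F a b)
link? F a b = (parent F a ≟ b) ×-dec (rank F b <? rank F a)

linked-downward : ∀ F {a b} → Linked F a b → rank F b ≤ rank F a → parent F a ≡ b
linked-downward F (inj₁ (p , _)) _ = p
linked-downward F (inj₂ (_ , a<b)) b≤a = ⊥-elim (<⇒≱ a<b b≤a)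

linked? : ∀ F a b → Dec (Linked F a b)
linked? F a b = link? F a b ⊎-dec link? F b a

module ColouredWalks {n} (G : Graph n) (c : Colouring n) where

  open import Data.List.Membership.DecPropositional (_≟ᶠ_ {n}) using (_∈?_)

  private
    variable
      β : Bool
      t v x y z : Fin n
      U : Fin n → Set

  Edge : Bool → Fin n → Fin n → Set
  Edge β x y = E G x y ≡ true × col c x y ≡ β

  Edge-sym : Edge β x y → Edge β y x
  Edge-sym {x = x} {y} (e , κ) = trans (E-sym G y x) e , trans (csym c y x) κ

  infixr 5 _∷_ _++ʷ_

  data Walk (β : Bool) : Fin n → Fin n → Set where
    []  : Walk β x x
    _∷_ : Edge β x y → Walk β y z → Walk β x z

  -- Kept separate from the start so that `vertices (e ∷ w)` computes to `x ∷ vertices w`.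
  visited : Walk β x y → List (Fin n)
  visited [] = []
  visited (_∷_ {y = y} _ w) = y ∷ visited w

  vertices : Walk β x y → List (Fin n)
  vertices {x = x} w = x ∷ visited w

  _++ʷ_ : Walk β x y → Walk β y z → Walk β x z
  [] ++ʷ w = w
  (e ∷ v) ++ʷ w = e ∷ (v ++ʷ w)

  All-++ʷ : ∀ {P : Fin n → Set} (v : Walk β x y) {w : Walk β y z} →
    All P (vertices v) → All P (vertices w) → All P (vertices (v ++ʷ w))
  All-++ʷ [] _ pw = pw
  All-++ʷ (_ ∷ v) (px ∷ pv) pw = px ∷ All-++ʷ v pv pw

  reverse : Walk β x y → Walk β y x
  reverse [] = []
  reverse (e ∷ w) = reverse w ++ʷ Edge-sym e ∷ []

  All-reverse : ∀ {P : Fin n → Set} (w : Walk β x y) → All P (vertices w) → All P (vertices (reverse w))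
  All-reverse [] p = p
  All-reverse (_ ∷ w) (px ∷ pw) = All-++ʷ (reverse w) (All-reverse w pw) (All.head pw ∷ px ∷ [])

  Joined : Bool → (Fin n → Set) → Fin n → Fin n → Set
  Joined β U x y = Σ (Walk β x y) λ w → All U (vertices w)

  joined-refl : U x → Joined β U x x
  joined-refl ux = [] , ux ∷ []

  joined-step : U x → Edge β x y → Joined β U y z → Joined β U x z
  joined-step ux e (w , uw) = e ∷ w , ux ∷ uw

  joined-sym : Joined β U x y → Joined β U y x
  joined-sym (w , uw) = reverse w , All-reverse w uw

  joined-trans : Joined β U x y → Joined β U y z → Joined β U x z
  joined-trans (v , uv) (w , uw) = v ++ʷ w , All-++ʷ v uv uw

  joined-mono : ∀ {U′ : Fin n → Set} → (∀ {x} → U x → U′ x) → Joined β U x y → Joined β U′ x y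
  joined-mono U⊆U′ (w , uw) = w , All.map U⊆U′ uw

  suffixFrom : (w : Walk β y z) → x ∈ vertices w →
    Σ (Walk β x z) λ s → (Unique (vertices w) → Unique (vertices s)) × vertices s ⊆ vertices w
  suffixFrom w (here refl) = w , id , id
  suffixFrom (_ ∷ w) (there x∈) with suffixFrom w x∈
  ... | s , unique , s⊆w = s , unique ∘ AllPairs.tail , there ∘ s⊆w

  loopErase : (w : Walk β x y) → Σ (Walk β x y) λ p → Unique (vertices p) × vertices p ⊆ vertices w
  loopErase [] = [] , [] ∷ [] , id
  loopErase {x = x} (e ∷ w) with loopErase w
  ... | p , unique , p⊆w with x ∈? vertices p
  ...   | yes x∈p = let s , unique′ , s⊆p = suffixFrom p x∈p in s , unique′ unique , there ∘ p⊆w ∘ s⊆p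
  ...   | no x∉p = e ∷ p , ¬Any⇒All¬ _ x∉p ∷ unique , ∷⁺ʳ x p⊆w

  lookup-step : (w : Walk β x y) (i j : Fin (length (vertices w))) → toℕ j ≡ suc (toℕ i) →
    Edge β (lookup (vertices w) i) (lookup (vertices w) j)
  lookup-step [] fzero fzero ()
  lookup-step (e ∷ _) fzero (fsuc fzero) _ = e
  lookup-step (_ ∷ _) fzero (fsuc (fsuc _)) ()
  lookup-step (_ ∷ _) (fsuc _) fzero ()
  lookup-step (_ ∷ w) (fsuc i) (fsuc j) eq = lookup-step w i j (suc-injective eq)

  lookup-last : (w : Walk β x y) (i : Fin (length (vertices w))) → suc (toℕ i) ≡ length (vertices w) →
    lookup (vertices w) i ≡ y
  lookup-last [] fzero _ = refl
  lookup-last (_ ∷ _) fzero ()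
  lookup-last (_ ∷ w) (fsuc i) eq = lookup-last w i (suc-injective eq)

  closedPath⇒cycle : (e₁ : Edge β x y) (e₂ : Edge β y z) (w : Walk β z t) →
    Unique (vertices (e₁ ∷ e₂ ∷ w)) → Edge β t x → MonoCycle G c
  closedPath⇒cycle {β} e₁ e₂ w unique closing =
    β , length (visited w) , lookup (vertices p) , (λ {i} {j} → lookup-injective unique i j) , adjacent
    where
    p = e₁ ∷ e₂ ∷ w
    open CyclicSuccessor {length (visited w)}
    adjacent : ∀ i → Edge β (lookup (vertices p) i) (lookup (vertices p) (next i))
    adjacent i with next-cases i
    ... | inj₁ (_ , succ) = lookup-step p i (next i) succ
    ... | inj₂ (last , wrap) rewrite lookup-last p i last | toℕ-injective {i = next i} {j = fzero} wrap = closing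

  path⇒cycle : (p : Walk β x y) → Unique (vertices p) → x ≢ y → v ∉ vertices p →
    Edge β v x → Edge β y v → MonoCycle G c
  path⇒cycle [] _ x≢y = ⊥-elim (x≢y refl)
  path⇒cycle (e ∷ p) unique _ v∉p ev ey = closedPath⇒cycle ev e p (¬Any⇒All¬ _ v∉p ∷ unique) ey

  joined⇒cycle : Joined β U x y → x ≢ y → ¬ U v → Edge β v x → Edge β y v → MonoCycle G c
  joined⇒cycle (w , uw) x≢y ¬uv ev ey with loopErase w
  ... | p , unique , p⊆w = path⇒cycle p unique x≢y (λ v∈p → ¬uv (All.lookup uw (p⊆w v∈p))) ev ey

  forest-acyclic : (F : Forest) (cyc : MonoCycle G c) →
    (∀ {x y} → Edge (proj₁ cyc) x y → Linked F (toℕ x) (toℕ y)) → ⊥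
  forest-acyclic F (β , m , f , injective , adjacent) linked =
    uncurry top-impossible (argmax-Fin (rank F ∘ toℕ ∘ f))
    where
    open CyclicSuccessor {m}
    -- both cycle-neighbours of the top-ranked vertex would have to be its parent
    top-impossible : (top : Fin (3 + m)) → (∀ i → rank F (toℕ (f i)) ≤ rank F (toℕ (f top))) → ⊥
    top-impossible top maximal = next-next≢ top (trans (cong next after≡before) (next-prev top))
      where
      parent-after : parent F (toℕ (f top)) ≡ toℕ (f (next top))
      parent-after = linked-downward F (linked (adjacent top)) (maximal (next top))
      parent-before : parent F (toℕ (f top)) ≡ toℕ (f (prev top))
      parent-before = linked-downward F
        (Sum.swap (linked (subst (λ i → Edge β (f (prev top)) (f i)) (next-prev top) (adjacent (prev top)))))
        (maximal (prev top))
      after≡before : next top ≡ prev top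
      after≡before = injective (toℕ-injective (trans (sym parent-after) parent-before))

forestColouring : ∀ {n} → Forest → Colouring n
forestColouring T = record
  { col = λ x y → does (linked? T (toℕ x) (toℕ y))
  ; csym = λ x y → ∨-comm (does (link? T (toℕ x) (toℕ y))) (does (link? T (toℕ y) (toℕ x)))
  }

twoForests⇒¬InR : ∀ {n} (H : Graph n) (T F : Forest) →
  (∀ x y → E H x y ≡ true → Linked T (toℕ x) (toℕ y) ⊎ Linked F (toℕ x) (toℕ y)) → ¬ InR H
twoForests⇒¬InR H T F covered inR = acyclic (inR (forestColouring T))
  where
  open ColouredWalks H (forestColouring T)
  acyclic : MonoCycle H (forestColouring T) → ⊥
  acyclic cyc@(true , _) = forest-acyclic T cyc λ (_ , κ) → dec-true⁻¹ (linked? T _ _) κ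
  acyclic cyc@(false , _) = forest-acyclic F cyc λ {x} {y} (e , κ) →
    Sum.[ (λ t → ⊥-elim (dec-false⁻¹ (linked? T _ _) κ t)) , id ] (covered x y e)

module PrefixConnectivity {n} (G : Graph n) (c : Colouring n) where

  open ColouredWalks G c public

  private
    variable
      β : Bool
      i : ℕ
      a b u v w x y y′ z : Fin n

  InPrefix : ℕ → Fin n → Set
  InPrefix i x = toℕ x ≤ i

  Spans : Bool → ℕ → Fin n → Set
  Spans β i a = ∀ x → toℕ x ≤ i → Joined β (InPrefix i) x a

  TwoParts : Bool → ℕ → Fin n → Fin n → Set
  TwoParts β i a b = ∀ x → toℕ x ≤ i → Joined β (InPrefix i) x a ⊎ Joined β (InPrefix i) x b

  BothSpanning : ℕ → Fin n → Set
  BothSpanning i a = ∀ β → Spans β i a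

  record OneSpanning (i : ℕ) (a : Fin n) : Set where
    field
      colour   : Bool
      spanning : Spans colour i a
      p q      : Fin n
      split    : TwoParts (not colour) i p q

  edge-colour : ∀ β → E G x y ≡ true → Edge β x y ⊎ Edge (not β) x y
  edge-colour {x} {y} β e = Sum.map (e ,_) (e ,_) (bool-split (col c x y) β)

  fresh : toℕ v ≡ suc i → ¬ InPrefix i v
  fresh v≡ v≤ = 1+n≰n (subst (_≤ _) v≡ v≤)

  prefix-suc : toℕ v ≡ suc i → toℕ x ≤ suc i → toℕ x ≤ i ⊎ x ≡ v
  prefix-suc {v} {x = x} v≡ x≤ with m≤n⇒m<n∨m≡n x≤
  ... | inj₁ x< = inj₁ (s≤s⁻¹ x<)
  ... | inj₂ x≡ = inj₂ (toℕ-injective (trans x≡ (sym v≡)))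

  widen : Joined β (InPrefix i) x y → Joined β (InPrefix (suc i)) x y
  widen = joined-mono m≤n⇒m≤1+n

  joined-spanned : Spans β i a → toℕ x ≤ i → toℕ y ≤ i → Joined β (InPrefix i) x y
  joined-spanned spans x≤ y≤ = joined-trans (spans _ x≤) (joined-sym (spans _ y≤))

  close : Joined β (InPrefix i) x y → toℕ v ≡ suc i → x ≢ y → Edge β v x → Edge β v y → MonoCycle G c
  close x~y v≡ x≢y vx vy = joined⇒cycle x~y x≢y (fresh v≡) vx (Edge-sym vy)

  spans-extend : Spans β i a → toℕ v ≡ suc i → toℕ x ≤ i → Edge β v x → Spans β (suc i) a
  spans-extend spans v≡ x≤ vx y y≤ with prefix-suc v≡ y≤
  ... | inj₁ y≤i = widen (spans y y≤i)
  ... | inj₂ refl = joined-step (≤-reflexive v≡) vx (widen (spans _ x≤))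

  spans-reanchor : Spans β i a → toℕ b ≤ i → Spans β i b
  spans-reanchor spans b≤ x x≤ = joined-spanned spans x≤ b≤

  spans⇒twoParts : Spans β i a → toℕ v ≡ suc i → TwoParts β (suc i) a v
  spans⇒twoParts spans v≡ x x≤ with prefix-suc v≡ x≤
  ... | inj₁ x≤i = inj₁ (widen (spans x x≤i))
  ... | inj₂ refl = inj₂ (joined-refl (≤-reflexive v≡))

  twoParts-extend : TwoParts β i a b → toℕ v ≡ suc i → toℕ x ≤ i → Edge β v x → TwoParts β (suc i) a b
  twoParts-extend parts v≡ x≤ vx y y≤ with prefix-suc v≡ y≤
  ... | inj₁ y≤i = Sum.map widen widen (parts y y≤i)
  ... | inj₂ refl =
    Sum.map (joined-step (≤-reflexive v≡) vx ∘ widen) (joined-step (≤-reflexive v≡) vx ∘ widen) (parts _ x≤)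

  edge-joined : toℕ x ≤ i → toℕ v ≡ suc i → Edge β v x → Joined β (InPrefix (suc i)) x v
  edge-joined x≤ v≡ vx = joined-step (m≤n⇒m≤1+n x≤) (Edge-sym vx) (joined-refl (≤-reflexive v≡))

  merge : TwoParts β i a b → toℕ v ≡ suc i → toℕ x ≤ i → toℕ y ≤ i →
    Joined β (InPrefix i) x a → Joined β (InPrefix i) y b → Edge β v x → Edge β v y → Spans β (suc i) v
  merge parts v≡ x≤ y≤ x~a y~b vx vy z z≤ with prefix-suc v≡ z≤
  ... | inj₂ refl = joined-refl (≤-reflexive v≡)
  ... | inj₁ z≤i with parts z z≤i
  ...   | inj₁ z~a = joined-trans (widen (joined-trans z~a (joined-sym x~a))) (edge-joined x≤ v≡ vx)
  ...   | inj₂ z~b = joined-trans (widen (joined-trans z~b (joined-sym y~b))) (edge-joined y≤ v≡ vy)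

  twoParts-merge : TwoParts β i a b → toℕ v ≡ suc i → toℕ x ≤ i → toℕ y ≤ i → x ≢ y →
    Edge β v x → Edge β v y → MonoCycle G c ⊎ Spans β (suc i) v
  twoParts-merge parts v≡ x≤ y≤ x≢y vx vy with parts _ x≤ | parts _ y≤
  ... | inj₁ x~a | inj₁ y~a = inj₁ (close (joined-trans x~a (joined-sym y~a)) v≡ x≢y vx vy)
  ... | inj₂ x~b | inj₂ y~b = inj₁ (close (joined-trans x~b (joined-sym y~b)) v≡ x≢y vx vy)
  ... | inj₁ x~a | inj₂ y~b = inj₂ (merge parts v≡ x≤ y≤ x~a y~b vx vy)
  ... | inj₂ x~b | inj₁ y~a = inj₂ (merge parts v≡ y≤ x≤ y~a x~b vy vx)

  twoParts-close : TwoParts β i a b → toℕ v ≡ suc i → toℕ x ≤ i → toℕ y ≤ i → toℕ z ≤ i →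
    x ≢ y → x ≢ z → y ≢ z → Edge β v x → Edge β v y → Edge β v z → MonoCycle G c
  twoParts-close parts v≡ x≤ y≤ z≤ x≢y x≢z y≢z vx vy vz with parts _ x≤ | parts _ y≤ | parts _ z≤
  ... | inj₁ x~ | inj₁ y~ | _       = close (joined-trans x~ (joined-sym y~)) v≡ x≢y vx vy
  ... | inj₂ x~ | inj₂ y~ | _       = close (joined-trans x~ (joined-sym y~)) v≡ x≢y vx vy
  ... | inj₁ x~ | inj₂ _  | inj₁ z~ = close (joined-trans x~ (joined-sym z~)) v≡ x≢z vx vz
  ... | inj₂ x~ | inj₁ _  | inj₂ z~ = close (joined-trans x~ (joined-sym z~)) v≡ x≢z vx vz
  ... | inj₁ _  | inj₂ y~ | inj₂ z~ = close (joined-trans y~ (joined-sym z~)) v≡ y≢z vy vz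
  ... | inj₂ _  | inj₁ y~ | inj₁ z~ = close (joined-trans y~ (joined-sym z~)) v≡ y≢z vy vz

  oneSpanning-step : OneSpanning i a → toℕ a ≤ i → toℕ v ≡ suc i →
    toℕ x ≤ i → toℕ y ≤ i → x ≢ y →
    E G v x ≡ true → E G v y ≡ true → MonoCycle G c ⊎ OneSpanning (suc i) a
  oneSpanning-step {i} {a} {v} record { colour = β ; spanning = spans ; p = p ; q = q ; split = parts }
    a≤ v≡ x≤ y≤ x≢y ex ey with edge-colour β ex | edge-colour β ey
  ... | inj₁ vx | inj₁ vy = inj₁ (close (joined-spanned spans x≤ y≤) v≡ x≢y vx vy)
  ... | inj₁ vx | inj₂ vy = inj₂ record
    { colour = β ; spanning = spans-extend spans v≡ x≤ vx
    ; p = p ; q = q ; split = twoParts-extend parts v≡ y≤ vy }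
  ... | inj₂ vx | inj₁ vy = inj₂ record
    { colour = β ; spanning = spans-extend spans v≡ y≤ vy
    ; p = p ; q = q ; split = twoParts-extend parts v≡ x≤ vx }
  ... | inj₂ vx | inj₂ vy with twoParts-merge parts v≡ x≤ y≤ x≢y vx vy
  ...   | inj₁ cyc = inj₁ cyc
  ...   | inj₂ spans′ = inj₂ record
    { colour = not β ; spanning = spans-reanchor spans′ (m≤n⇒m≤1+n a≤) ; p = a ; q = v
    ; split = subst (λ γ → TwoParts γ (suc i) a v) (sym (not-involutive β)) (spans⇒twoParts spans v≡) }

  spans-complete : Spans β i a → TwoParts (not β) i u w → toℕ a ≤ i → toℕ v ≡ suc i →
    toℕ x ≤ i → toℕ y ≤ i → toℕ y′ ≤ i → y ≢ y′ →
    Edge β v x → Edge (not β) v y → Edge (not β) v y′ → MonoCycle G c ⊎ BothSpanning (suc i) a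
  spans-complete {β} {i} {a} spans parts a≤ v≡ x≤ y≤ y′≤ y≢y′ vx vy vy′
    with twoParts-merge parts v≡ y≤ y′≤ y≢y′ vy vy′
  ... | inj₁ cyc = inj₁ cyc
  ... | inj₂ spans′ =
    inj₂ (bool-cases {λ δ → Spans δ (suc i) a} β
      (spans-extend spans v≡ x≤ vx) (spans-reanchor spans′ (m≤n⇒m≤1+n a≤)))

  oneSpanning-step₃ : OneSpanning i a → toℕ a ≤ i → toℕ v ≡ suc i →
    toℕ x ≤ i → toℕ y ≤ i → toℕ z ≤ i →
    x ≢ y → x ≢ z → y ≢ z → E G v x ≡ true → E G v y ≡ true → E G v z ≡ true →
    MonoCycle G c ⊎ BothSpanning (suc i) a
  oneSpanning-step₃ record { colour = β ; spanning = spans ; split = parts }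
    a≤ v≡ x≤ y≤ z≤ x≢y x≢z y≢z ex ey ez with edge-colour β ex | edge-colour β ey | edge-colour β ez
  ... | inj₁ vx | inj₁ vy | _       = inj₁ (close (joined-spanned spans x≤ y≤) v≡ x≢y vx vy)
  ... | inj₁ vx | inj₂ _  | inj₁ vz = inj₁ (close (joined-spanned spans x≤ z≤) v≡ x≢z vx vz)
  ... | inj₂ _  | inj₁ vy | inj₁ vz = inj₁ (close (joined-spanned spans y≤ z≤) v≡ y≢z vy vz)
  ... | inj₁ vx | inj₂ vy | inj₂ vz = spans-complete spans parts a≤ v≡ x≤ y≤ z≤ y≢z vx vy vz
  ... | inj₂ vx | inj₁ vy | inj₂ vz = spans-complete spans parts a≤ v≡ y≤ x≤ z≤ x≢z vy vx vz
  ... | inj₂ vx | inj₂ vy | inj₁ vz = spans-complete spans parts a≤ v≡ z≤ x≤ y≤ x≢y vz vx vy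
  ... | inj₂ vx | inj₂ vy | inj₂ vz = inj₁ (twoParts-close parts v≡ x≤ y≤ z≤ x≢y x≢z y≢z vx vy vz)

  bothSpanning-step : BothSpanning i a → toℕ v ≡ suc i → toℕ x ≤ i → toℕ y ≤ i → x ≢ y →
    E G v x ≡ true → E G v y ≡ true → MonoCycle G c ⊎ BothSpanning (suc i) a
  bothSpanning-step {i} {a} {v} {x} spans v≡ x≤ y≤ x≢y ex ey with edge-colour (col c v x) ey
  ... | inj₁ vy = inj₁ (close (joined-spanned (spans _) x≤ y≤) v≡ x≢y (ex , refl) vy)
  ... | inj₂ vy = inj₂ (bool-cases {λ δ → Spans δ (suc i) a} (col c v x)
    (spans-extend (spans _) v≡ x≤ (ex , refl)) (spans-extend (spans _) v≡ y≤ vy))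

  bothSpanning-close : BothSpanning i a → toℕ v ≡ suc i → toℕ x ≤ i → toℕ y ≤ i → toℕ z ≤ i →
    x ≢ y → x ≢ z → y ≢ z → E G v x ≡ true → E G v y ≡ true → E G v z ≡ true → MonoCycle G c
  bothSpanning-close {v = v} {x} spans v≡ x≤ y≤ z≤ x≢y x≢z y≢z ex ey ez
    with edge-colour (col c v x) ey | edge-colour (col c v x) ez
  ... | inj₁ vy | _       = close (joined-spanned (spans _) x≤ y≤) v≡ x≢y (ex , refl) vy
  ... | inj₂ _  | inj₁ vz = close (joined-spanned (spans _) x≤ z≤) v≡ x≢z (ex , refl) vz
  ... | inj₂ vy | inj₂ vz = close (joined-spanned (spans _) y≤ z≤) v≡ y≢z vy vz

module WheelWithChord (m : ℕ) where

  k : ℕ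
  k = 4 + m

  Vertex : Set
  Vertex = Fin (suc k)

  toℕ≤k : (x : Vertex) → toℕ x ≤ k
  toℕ≤k x = s≤s⁻¹ (toℕ<n x)

  -- Each edge is listed once, smaller endpoint first; the rim is the cycle 1, 2, …, k, 1.
  data Arc : ℕ → ℕ → Set where
    spoke   : ∀ b → Arc 0 (suc b)
    rim     : ∀ a → Arc (suc a) (suc (suc a))
    closing : Arc 1 k
    chord   : Arc 1 3

  arc-< : ∀ {a b} → Arc a b → a < b
  arc-< (spoke _) = s≤s z≤n
  arc-< (rim _) = n<1+n _
  arc-< closing = s≤s (s≤s z≤n)
  arc-< chord = s≤s (s≤s z≤n)

  arc? : ∀ a b → Dec (Arc a b)
  arc? zero zero = no λ ()
  arc? zero (suc b) = yes (spoke b)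
  arc? (suc a) b with b ≟ suc (suc a)
  ... | yes refl = yes (rim a)
  arc? (suc zero) b | no ¬rim with b ≟ k | b ≟ 3
  ... | yes refl | _ = yes closing
  ... | no _ | yes refl = yes chord
  ... | no ¬closing | no ¬chord = no λ { (rim _) → ¬rim refl ; closing → ¬closing refl ; chord → ¬chord refl }
  arc? (suc (suc a)) b | no ¬rim = no λ { (rim _) → ¬rim refl }

  Adjacent : ℕ → ℕ → Set
  Adjacent a b = Arc a b ⊎ Arc b a

  adjacent? : ∀ a b → Dec (Adjacent a b)
  adjacent? a b = arc? a b ⊎-dec arc? b a

  G : Graph (suc k)
  G = record
    { V = λ _ → true
    ; E = λ x y → does (adjacent? (toℕ x) (toℕ y))
    ; sym = λ x y → ∨-comm (does (arc? (toℕ x) (toℕ y))) (does (arc? (toℕ y) (toℕ x)))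
    ; irr = λ x → dec-false (adjacent? (toℕ x) (toℕ x)) Sum.[ <-irrefl refl ∘ arc-< , <-irrefl refl ∘ arc-< ]
    ; E⇒V = λ _ _ _ → refl
    }

  vertex : ℕ → Vertex
  vertex a = fromℕ< (s≤s (m⊓n≤n a k))

  toℕ-vertex : ∀ {a} → a ≤ k → toℕ (vertex a) ≡ a
  toℕ-vertex a≤k = trans (toℕ-fromℕ< _) (m≤n⇒m⊓n≡m a≤k)

  hub : Vertex
  hub = fzero

  arc⇒E : ∀ {a b} → Arc a b → b ≤ k → E G (vertex b) (vertex a) ≡ true
  arc⇒E {a} {b} arc b≤k
    rewrite toℕ-vertex b≤k | toℕ-vertex (≤-trans (<⇒≤ (arc-< arc)) b≤k)
    = dec-true (adjacent? b a) (inj₂ arc)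

  vertex-≢ : ∀ {a b} → a ≤ k → b ≤ k → a ≢ b → vertex a ≢ vertex b
  vertex-≢ a≤k b≤k a≢b eq = a≢b (trans (sym (toℕ-vertex a≤k)) (trans (cong toℕ eq) (toℕ-vertex b≤k)))

  module _ (c : Colouring (suc k)) where

    open PrefixConnectivity G c

    prefix₁ : OneSpanning 1 hub
    prefix₁ = record { colour = col c (# 1) hub ; spanning = spanning ; p = hub ; q = # 1 ; split = split }
      where
      spanning : Spans (col c (# 1) hub) 1 hub
      spanning fzero _ = joined-refl z≤n
      spanning (fsuc fzero) _ = joined-step (s≤s z≤n) (refl , refl) (joined-refl z≤n)
      spanning (fsuc (fsuc _)) (s≤s ())
      split : TwoParts (not (col c (# 1) hub)) 1 hub (# 1)
      split fzero _ = inj₁ (joined-refl z≤n)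
      split (fsuc fzero) _ = inj₂ (joined-refl (s≤s z≤n))
      split (fsuc (fsuc _)) (s≤s ())

    prefix₂ : MonoCycle G c ⊎ OneSpanning 2 hub
    prefix₂ = oneSpanning-step {v = # 2} {x = hub} {y = # 1} prefix₁ z≤n refl z≤n (s≤s z≤n) (λ ()) refl refl

    prefix₃ : MonoCycle G c ⊎ BothSpanning 3 hub
    prefix₃ = [ inj₁ , (λ state → oneSpanning-step₃ {v = # 3} {x = hub} {y = # 1} {z = # 2} state z≤n refl
                    z≤n (s≤s z≤n) (s≤s (s≤s z≤n)) (λ ()) (λ ()) (λ ()) refl refl refl) ]′ prefix₂

    prefix : ∀ j → j ≤ m → MonoCycle G c ⊎ BothSpanning (3 + j) hub
    prefix zero _ = prefix₃
    prefix (suc j) j<m = [ inj₁ , extend ]′ (prefix j (≤-trans (n≤1+n j) j<m))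
      where
      4+j≤k : 4 + j ≤ k
      4+j≤k = +-monoʳ-≤ 4 (≤-trans (n≤1+n j) j<m)
      3+j≤k : 3 + j ≤ k
      3+j≤k = ≤-trans (n≤1+n _) 4+j≤k
      extend : BothSpanning (3 + j) hub → MonoCycle G c ⊎ BothSpanning (4 + j) hub
      extend spans = bothSpanning-step spans (toℕ-vertex 4+j≤k) z≤n (≤-reflexive (toℕ-vertex 3+j≤k))
        (vertex-≢ z≤n 3+j≤k λ ()) (arc⇒E (spoke (3 + j)) 4+j≤k) (arc⇒E (rim (2 + j)) 4+j≤k)

    closeRim : BothSpanning (3 + m) hub → MonoCycle G c
    closeRim spans =
      bothSpanning-close spans (toℕ-vertex ≤-refl) z≤n (s≤s z≤n) (≤-reflexive (toℕ-vertex 3+m≤k))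
      (λ ()) (vertex-≢ z≤n 3+m≤k λ ()) (vertex-≢ (s≤s z≤n) 3+m≤k λ ())
      (arc⇒E (spoke (3 + m)) ≤-refl) (arc⇒E closing ≤-refl) (arc⇒E (rim (2 + m)) ≤-refl)
      where
      3+m≤k : 3 + m ≤ k
      3+m≤k = n≤1+n _

    monoCycle : MonoCycle G c
    monoCycle = [ id , closeRim ]′ (prefix m ≤-refl)

  inR : InR G
  inR = monoCycle

  -- The hub tree with vertex 1 hung below s instead of below the hub.
  starForest : ℕ → Forest
  starForest s = record { parent = parent′ ; rank = rank′ }
    where
    parent′ : ℕ → ℕ
    parent′ 1 = s
    parent′ _ = 0
    rank′ : ℕ → ℕ
    rank′ 0 = 0
    rank′ 1 = 2
    rank′ _ = 1

  -- The spoke 0–1 followed by the rim with the edge from j to its rim successor removed.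
  rimForest : ℕ → Forest
  rimForest j = record
    { parent = λ x → if does (x ≤? j) then x ∸ 1 else if does (suc x ≤? k) then suc x else 1
    ; rank = λ x → if does (x ≤? j) then x else (2 + k) ∸ x
    }

  rimForest-hub : ∀ j → 1 ≤ j → Link (rimForest j) 1 0
  rimForest-hub j 1≤j rewrite dec-true (1 ≤? j) 1≤j = refl , s≤s z≤n

  rimForest-below : ∀ j {a} → suc a ≤ j → Link (rimForest j) (suc a) a
  rimForest-below j {a} a<j rewrite dec-true (suc a ≤? j) a<j | dec-true (a ≤? j) (<⇒≤ a<j) = refl , n<1+n a

  rimForest-above : ∀ j {a} → j < a → suc a ≤ k → Link (rimForest j) a (suc a)
  rimForest-above j {a} j<a a<k
    rewrite dec-false (a ≤? j) (<⇒≱ j<a) | dec-true (suc a ≤? k) a<k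
          | dec-false (suc a ≤? j) (<⇒≱ (m<n⇒m<1+n j<a))
    = refl , ∸-monoʳ-< (n<1+n a) (≤-trans a<k (≤-trans (n≤1+n k) (n≤1+n (suc k))))

  rimForest-closing : ∀ j → 1 ≤ j → j < k → Link (rimForest j) k 1
  rimForest-closing j 1≤j j<k
    rewrite dec-false (k ≤? j) (<⇒≱ j<k) | dec-false (suc k ≤? k) 1+n≰n
          | dec-true (1 ≤? j) 1≤j | m+n∸n≡m 2 k
    = refl , s≤s (s≤s z≤n)

  rimForest-rim : ∀ j {a} → suc a ≢ j → suc (suc a) ≤ k → Linked (rimForest j) (suc a) (suc (suc a))
  rimForest-rim j {a} a+1≢j a+2≤k with <-cmp (suc a) j
  ... | tri< a+1<j _ _ = inj₂ (rimForest-below j a+1<j)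
  ... | tri≈ _ a+1≡j _ = ⊥-elim (a+1≢j a+1≡j)
  ... | tri> _ _ j<a+1 = inj₁ (rimForest-above j j<a+1 a+2≤k)

  -- The hub tree without the spoke to i ≥ 2: vertex i hangs from its rim successor, vertex 1 from 3.
  detourForest : ℕ → Forest
  detourForest i = record { parent = parent′ ; rank = rank′ }
    where
    parent′ : ℕ → ℕ
    parent′ 0 = 0
    parent′ 1 = 3
    parent′ x@(suc (suc _)) = if does (x ≟ i) then (if does (suc i ≤? k) then suc i else 1) else 0
    rank′ : ℕ → ℕ
    rank′ 0 = 0
    rank′ 1 = 3
    rank′ x@(suc (suc _)) = if does (x ≟ i) then (if does (suc i ≤? k) then 2 else 4) else 1

  detourForest-spoke : ∀ i {b} → suc (suc b) ≢ i → Link (detourForest i) (suc (suc b)) 0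
  detourForest-spoke i {b} b+2≢i rewrite dec-false (suc (suc b) ≟ i) b+2≢i = refl , s≤s z≤n

  detourForest-rim : ∀ {b} → suc (suc (suc b)) ≤ k →
    Link (detourForest (suc (suc b))) (suc (suc b)) (suc (suc (suc b)))
  detourForest-rim {b} b+3≤k
    rewrite dec-true (suc (suc b) ≟ suc (suc b)) refl | dec-true (suc (suc (suc b)) ≤? k) b+3≤k
          | dec-false (suc (suc (suc b)) ≟ suc (suc b)) (1+n≢n) = refl , s≤s (s≤s z≤n)

  detourForest-closing : Link (detourForest k) k 1
  detourForest-closing rewrite dec-true (k ≟ k) refl | dec-false (suc k ≤? k) 1+n≰n =
    refl , s≤s (s≤s (s≤s (s≤s z≤n)))

  detourForest-chord : ∀ i → Link (detourForest i) 1 3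
  detourForest-chord i with 3 ≟ i
  ... | yes refl = refl , s≤s (s≤s (s≤s z≤n))
  ... | no 3≢i rewrite dec-false (3 ≟ i) 3≢i = refl , s≤s (s≤s z≤n)

  -- With the spoke 0–1 removed: 2 hangs below 1, which hangs below 3.
  chainForest : Forest
  chainForest = record { parent = parent′ ; rank = rank′ }
    where
    parent′ : ℕ → ℕ
    parent′ 1 = 3
    parent′ 2 = 1
    parent′ _ = 0
    rank′ : ℕ → ℕ
    rank′ 0 = 0
    rank′ 1 = 2
    rank′ 2 = 3
    rank′ _ = 1

  -- The spoke 0–2 followed by the rim path 2, 3, …, k, 1.
  rimPathForest : Forest
  rimPathForest = record { parent = parent′ ; rank = rank′ }
    where
    parent′ : ℕ → ℕ
    parent′ 1 = k
    parent′ (suc (suc (suc x))) = suc (suc x)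
    parent′ _ = 0
    rank′ : ℕ → ℕ
    rank′ 0 = 0
    rank′ 1 = k
    rank′ (suc x) = x

  Covers : Forest → Forest → ℕ → ℕ → Set
  Covers T F a b =
    ∀ {a′ b′} → Arc a′ b′ → b′ ≤ k → (a′ , b′) ≢ (a , b) → Linked T a′ b′ ⊎ Linked F a′ b′

  covers-spoke₁ : Covers chainForest rimPathForest 0 1
  covers-spoke₁ (spoke zero) _ ≢01 = ⊥-elim (≢01 refl)
  covers-spoke₁ (spoke (suc zero)) _ _ = inj₂ (inj₂ (refl , s≤s z≤n))
  covers-spoke₁ (spoke (suc (suc _))) _ _ = inj₁ (inj₂ (refl , s≤s z≤n))
  covers-spoke₁ (rim zero) _ _ = inj₁ (inj₂ (refl , s≤s (s≤s (s≤s z≤n))))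
  covers-spoke₁ (rim (suc a)) _ _ = inj₂ (inj₂ (refl , n<1+n _))
  covers-spoke₁ closing _ _ = inj₂ (inj₁ (refl , n<1+n _))
  covers-spoke₁ chord _ _ = inj₁ (inj₁ (refl , s≤s (s≤s z≤n)))

  covers-spoke : ∀ b → suc (suc b) ≤ k →
    Covers (detourForest (suc (suc b))) (rimForest (suc (suc b))) 0 (suc (suc b))
  covers-spoke b _ (spoke zero) _ _ = inj₂ (inj₂ (rimForest-hub (suc (suc b)) (s≤s z≤n)))
  covers-spoke b _ (spoke (suc b′)) _ ≢spoke =
    inj₁ (inj₂ (detourForest-spoke (suc (suc b)) (≢spoke ∘ cong (0 ,_))))
  covers-spoke b _ (rim a) a+2≤k _ with suc a ≟ suc (suc b)
  ... | yes refl = inj₁ (inj₁ (detourForest-rim a+2≤k))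
  ... | no a+1≢b+2 = inj₂ (rimForest-rim (suc (suc b)) a+1≢b+2 a+2≤k)
  covers-spoke b b+2≤k closing _ _ with suc (suc b) ≟ k
  ... | yes refl = inj₁ (inj₂ detourForest-closing)
  ... | no b+2≢k = inj₂ (inj₂ (rimForest-closing (suc (suc b)) (s≤s z≤n) (≤∧≢⇒< b+2≤k b+2≢k)))
  covers-spoke b _ chord _ _ = inj₁ (inj₁ (detourForest-chord (suc (suc b))))

  covers-rim : ∀ a → suc (suc a) ≤ k → Covers (starForest 3) (rimForest (suc a)) (suc a) (suc (suc a))
  covers-rim a _ (spoke zero) _ _ = inj₂ (inj₂ (rimForest-hub (suc a) (s≤s z≤n)))
  covers-rim a _ (spoke (suc _)) _ _ = inj₁ (inj₂ (refl , s≤s z≤n))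
  covers-rim a _ (rim a′) a′+2≤k ≢rim =
    inj₂ (rimForest-rim (suc a) (λ eq → ≢rim (cong₂ _,_ eq (cong suc eq))) a′+2≤k)
  covers-rim a a+2≤k closing _ _ = inj₂ (inj₂ (rimForest-closing (suc a) (s≤s z≤n) a+2≤k))
  covers-rim a _ chord _ _ = inj₁ (inj₁ (refl , s≤s (s≤s z≤n)))

  covers-closing : Covers (starForest 3) (rimForest k) 1 k
  covers-closing (spoke zero) _ _ = inj₂ (inj₂ (rimForest-hub k (s≤s z≤n)))
  covers-closing (spoke (suc _)) _ _ = inj₁ (inj₂ (refl , s≤s z≤n))
  covers-closing (rim a) a+2≤k _ = inj₂ (inj₂ (rimForest-below k a+2≤k))
  covers-closing closing _ ≢closing = ⊥-elim (≢closing refl)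
  covers-closing chord _ _ = inj₁ (inj₁ (refl , s≤s (s≤s z≤n)))

  covers-chord : Covers (starForest 2) (rimForest 1) 1 3
  covers-chord (spoke zero) _ _ = inj₂ (inj₂ (rimForest-hub 1 (s≤s z≤n)))
  covers-chord (spoke (suc _)) _ _ = inj₁ (inj₂ (refl , s≤s z≤n))
  covers-chord (rim zero) _ _ = inj₁ (inj₁ (refl , s≤s (s≤s z≤n)))
  covers-chord (rim (suc a)) a+3≤k _ = inj₂ (inj₁ (rimForest-above 1 (s≤s (s≤s z≤n)) a+3≤k))
  covers-chord closing _ _ = inj₂ (inj₂ (rimForest-closing 1 (s≤s z≤n) (s≤s (s≤s z≤n))))
  covers-chord chord _ ≢chord = ⊥-elim (≢chord refl)

  decompose : ∀ {a b} → Arc a b → b ≤ k → Σ Forest λ T → Σ Forest λ F → Covers T F a b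
  decompose (spoke zero) _ = chainForest , rimPathForest , covers-spoke₁
  decompose (spoke (suc b)) b+2≤k = _ , _ , covers-spoke b b+2≤k
  decompose (rim a) a+2≤k = _ , _ , covers-rim a a+2≤k
  decompose closing _ = _ , _ , covers-closing
  decompose chord _ = _ , _ , covers-chord

  Absent : Graph (suc k) → ℕ → ℕ → Set
  Absent H a b = ∀ x y → toℕ x ≡ a → toℕ y ≡ b → E H x y ≡ false

  absent-edge : ∀ (H : Graph (suc k)) {x y} → E H x y ≡ false → Absent H (toℕ x) (toℕ y)
  absent-edge H xy∉H _ _ x′≡ y′≡ rewrite toℕ-injective x′≡ | toℕ-injective y′≡ = xy∉H

  isolated : ∀ (H : Graph (suc k)) {x y} → V H x ≡ false → E H x y ≡ false
  isolated H {x} {y} x∉H with E H x y in e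
  ... | false = refl
  ... | true = ⊥-elim (true≢false (trans (sym (E⇒V H x y e)) x∉H))

  missingArc : ∀ H → ProperSubgraph H G → Σ ℕ λ a → Σ ℕ λ b → Arc a b × b ≤ k × Absent H a b
  missingArc H (_ , _ , inj₂ (x , y , xy∈G , xy∉H)) with dec-true⁻¹ (adjacent? (toℕ x) (toℕ y)) xy∈G
  ... | inj₁ arc = _ , _ , arc , toℕ≤k y , absent-edge H xy∉H
  ... | inj₂ arc = _ , _ , arc , toℕ≤k x , absent-edge H (trans (E-sym H y x) xy∉H)
  missingArc H (_ , _ , inj₁ (fzero , _ , 0∉H)) =
    _ , _ , spoke 0 , s≤s z≤n , λ { x y x≡0 _ →
      isolated H (subst (λ u → V H u ≡ false) (toℕ-injective (sym x≡0)) 0∉H) }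
  missingArc H (_ , _ , inj₁ (fsuc i , _ , i+1∉H)) =
    _ , _ , spoke (toℕ i) , toℕ≤k (fsuc i) , λ { x y _ y≡i+1 →
      trans (E-sym H x y)
        (isolated H (subst (λ u → V H u ≡ false) (toℕ-injective {j = y} (sym y≡i+1)) i+1∉H)) }

  minimal : (H : Graph (suc k)) → ProperSubgraph H G → ¬ InR H
  minimal H proper@(_ , H⊆G , _) with missingArc H proper
  ... | a , b , arc , b≤k , absent with decompose arc b≤k
  ...   | T , F , covers = twoForests⇒¬InR H T F covered
    where
    covered : ∀ x y → E H x y ≡ true → Linked T (toℕ x) (toℕ y) ⊎ Linked F (toℕ x) (toℕ y)
    covered x y xy∈H with dec-true⁻¹ (adjacent? (toℕ x) (toℕ y)) (H⊆G x y xy∈H)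
    ... | inj₁ arc′ = covers arc′ (toℕ≤k y) λ eq →
      true≢false (trans (sym xy∈H) (absent x y (cong proj₁ eq) (cong proj₂ eq)))
    ... | inj₂ arc′ = Sum.map Sum.swap Sum.swap (covers arc′ (toℕ≤k x) λ eq →
      true≢false (trans (sym xy∈H) (trans (E-sym H x y) (absent y x (cong proj₁ eq) (cong proj₂ eq)))))

  inM : InM G
  inM = inR , minimal

  hub-degree : degree G hub ≡ k
  hub-degree = begin
    length (filterᵇ (E G hub) (tabulate fsuc))
      ≡⟨ cong length (filter-all (T? ∘ E G hub) (tabulate⁺ {f = fsuc} λ _ → tt)) ⟩
    length (tabulate {n = k} fsuc)
      ≡⟨ length-tabulate fsuc ⟩
    k ∎
    where open ≡-Reasoning

  k≤maxDegree : k ≤ maxDegree G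
  k≤maxDegree = subst (_≤ maxDegree G) hub-degree (degree≤maxDegree G hub)

-- The construction works for every Δ.
corollary1p7 : (Δ : ℕ) → 1 ≤ Δ →
    Σ ℕ λ n → Σ (Graph n) λ G → InM G × (Δ ≤ maxDegree G)
corollary1p7 Δ _ = _ , G , inM , ≤-trans (m≤n+m Δ 4) k≤maxDegree
  where open WheelWithChord Δ
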